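{- Let $t$ be a non-negative integer, let $H$ be a $t$-tree, let $P$ be a path, and let $G$ be a subgraph of the strong product $H\boxtimes P$. Then $G$ has a proper odd colouring that uses at most $8t+4$ colours.
   Context: All graphs are finite and simple. A $t$-tree is a graph that is either a clique on $t+1$ vertices, or a graph $H$ containing a vertex $v$ of degree $t$ whose neighbours form a clique and such that $H-\{v\}$ is a $t$-tree. For graphs $A$ and $B$, the strong product $A\boxtimes B$ has vertex set $V(A)\times V(B)$, and $(x_1,y_1)(x_2,y_2)$ is an edge iff (i) $x_1x_2\in E(A)$ and $y_1=y_2$, or (ii) $x_1=x_2$ and $y_1y_2\in E(B)$, or (iii) $x_1x_2\in E(A)$ and $y_1y_2\in E(B)$. A vertex colouring $\varphi:V(G)\to\mathbb{N}$ (not necessarily proper) is odd if for every vertex $v$ with $|N_G(v)|>0$ there is a colour $\alpha$ such that $|\{w\in N_G(v):\varphi(w)=\alpha\}|$ is odd. It is proper if $vw\in E(G)$ implies $\varphi(v)\neq\varphi(w)$. A colouring uses $c$ colours if $|\{\varphi(v):v\in V(G)\}|=c$. -}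

module Defs where

open import Data.Nat using (ℕ; zero; suc; _+_; _%_; _≡ᵇ_)
open import Data.Bool using (Bool; true; false; _∧_; _∨_; if_then_else_)
open import Data.Fin using (Fin; toℕ; punchIn)
open import Data.List using (List; length; filterᵇ; allFin)
open import Data.Product using (_×_; _,_; Σ; ∃)
open import Data.Sum using (_⊎_)
open import Relation.Binary.PropositionalEquality using (_≡_; _≢_)

record Graph (n : ℕ) : Set where
  field
    adj    : Fin n → Fin n → Bool
    sym    : ∀ u v → adj u v ≡ adj v u
    irrefl : ∀ v → adj v v ≡ false
open Graph public

count : {n : ℕ} → (Fin n → Bool) → ℕ
count {n} p = length (filterᵇ p (allFin n))

degree : {n : ℕ} → Graph n → Fin n → ℕ
degree G v = count (adj G v)

deleteV : {n : ℕ} → Graph (suc n) → Fin (suc n) → Graph n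
deleteV G v = record
  { adj    = λ i j → adj G (punchIn v i) (punchIn v j)
  ; sym    = λ i j → sym G (punchIn v i) (punchIn v j)
  ; irrefl = λ i → irrefl G (punchIn v i)
  }

IsComplete : {n : ℕ} → Graph n → Set
IsComplete G = ∀ u w → u ≢ w → adj G u w ≡ true

NbhdClique : {n : ℕ} → Graph (suc n) → Fin (suc n) → Set
NbhdClique G v = ∀ u w → adj G v u ≡ true → adj G v w ≡ true → u ≢ w → adj G u w ≡ true

data TTree (t : ℕ) : {n : ℕ} → Graph n → Set where
  base   : (G : Graph (suc t)) → IsComplete G → TTree t G
  extend : {n : ℕ} (G : Graph (suc n)) (v : Fin (suc n)) →
           degree G v ≡ t → NbhdClique G v → TTree t (deleteV G v) → TTree t G

pathAdj : {m : ℕ} → Fin m → Fin m → Bool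
pathAdj i j = ((toℕ i + 1) ≡ᵇ toℕ j) ∨ ((toℕ j + 1) ≡ᵇ toℕ i)

StrongAdj : {a b : ℕ} → (Fin a → Fin a → Bool) → (Fin b → Fin b → Bool) →
            Fin a × Fin b → Fin a × Fin b → Set
StrongAdj adjA adjB (x₁ , y₁) (x₂ , y₂) =
  ((adjA x₁ x₂ ≡ true) × (y₁ ≡ y₂))
  ⊎ ((x₁ ≡ x₂) × (adjB y₁ y₂ ≡ true))
  ⊎ ((adjA x₁ x₂ ≡ true) × (adjB y₁ y₂ ≡ true))

-- G is (isomorphic to) a subgraph of H ⊠ P_m: an injective vertex map
-- sending edges of G to edges of the strong product
IsSubgraphOfStrongPath : {k n : ℕ} → Graph k → Graph n → (m : ℕ) → Set
IsSubgraphOfStrongPath {k} {n} G H m =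
  Σ (Fin k → Fin n × Fin m) λ f →
    (∀ u v → f u ≡ f v → u ≡ v) ×
    (∀ u v → adj G u v ≡ true → StrongAdj (adj H) (pathAdj {m}) (f u) (f v))

IsProper : {k : ℕ} → Graph k → (Fin k → ℕ) → Set
IsProper G φ = ∀ u v → adj G u v ≡ true → φ u ≢ φ v

IsOdd : {k : ℕ} → Graph k → (Fin k → ℕ) → Set
IsOdd G φ = ∀ v → (∃ λ w → adj G v w ≡ true) →
  ∃ λ α → count (λ w → adj G v w ∧ (φ w ≡ᵇ α)) % 2 ≡ 1

open import Data.Nat using (_≤_)
open import Data.List.Membership.Propositional using (_∈_)
UsesAtMost : {k : ℕ} → (Fin k → ℕ) → ℕ → Set
UsesAtMost {k} φ c = Σ (List ℕ) λ L → (length L ≤ c) × (∀ v → φ v ∈ L)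

{-# OPTIONS --safe #-}
-- A t-tree has an elimination order: every vertex has at most t earlier neighbours, and these
-- form a clique. Order the vertices of G lexicographically by (rank of the H-coordinate,
-- P-coordinate) and colour greedily, letting u avoid the colours of its earlier neighbours and of
-- the earliest neighbour s(v) of each neighbour v of u, whenever s(v) precedes u. The colouring is
-- proper, and odd because s(v) is the only neighbour of v with its colour. By the clique property
-- all vertices avoided by u sit in at most 8t + 3 positions of H ⊠ P (5t + 2 within distance two
-- of u, and the images under s of 3t + 1 positions within distance one), so 8t + 4 colours suffice.
module Submission where

open import Defs hiding (sym)
open import Data.Bool using (Bool; true; false; T; _∧_; if_then_else_)
open import Data.Bool.Properties using (T-≡; T-∧; ¬-not; ∧-identityʳ; ∧-zeroʳ)
open import Data.Empty using (⊥-elim)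
open import Data.Fin using (Fin; zero; suc; toℕ; punchIn; punchOut)
open import Data.Fin.Properties
  using (any?; pigeonhole; toℕ<n; toℕ≤pred[n]; toℕ-injective;
         punchInᵢ≢i; punchIn-punchOut; punchOut-punchIn; punchOut-cong)
  renaming (_≟_ to _≟ᶠ_)
open import Data.List
  using (List; []; _∷_; _++_; length; map; filter; filterᵇ; mapMaybe; cartesianProduct;
         tabulate; allFin; upTo; lookup)
open import Data.List.Extrema.Nat using (argmin; argmin-sel; f[argmin]≤f[⊤]; f[argmin]≤f[xs])
open import Data.List.Membership.Propositional using (_∈_; _∉_)
open import Data.List.Membership.Propositional.Properties
  using (∈-map⁺; ∈-++⁺ˡ; ∈-++⁺ʳ; ∈-++⁻; ∈-allFin; ∈-filter⁺; ∈-filter⁻; ∈-upTo⁺;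
         ∈-cartesianProduct⁺; ∈-cartesianProduct⁻)
open import Data.List.Properties
  using (length-filter; length-tabulate; length-map; length-++; length-mapMaybe; length-upTo;
         map-cong-local)
import Data.List.Relation.Unary.All as All
open import Data.List.Relation.Unary.Any using (here; there; index)
open import Data.List.Relation.Unary.Any.Properties using (lookup-index)
open import Data.Maybe using (Maybe; just; nothing; _>>=_)
open import Data.Nat using (ℕ; zero; suc; _+_; _*_; _∸_; _≤_; _<_; _<ᵇ_; _≡ᵇ_; z≤n; s≤s; _%_)
open import Data.Nat.Properties
open import Algebra.Properties.CommutativeSemigroup +-commutativeSemigroup using (x∙yz≈y∙xz)
open import Data.Nat.Tactic.RingSolver using (solve-∀)
open import Data.List.Membership.DecPropositional _≟_ using (_∈?_)
open import Data.Product using (Σ; _×_; _,_; ∃; proj₁; proj₂)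
open import Data.Product.Properties using (≡-dec; ×-≡,≡→≡)
open import Data.Sum using (_⊎_; inj₁; inj₂)
open import Function using (_∘_; Equivalence)
open import Relation.Binary.Definitions using (tri<; tri≈; tri>)
open import Relation.Binary.PropositionalEquality
open import Relation.Nullary using (yes; no; ¬_; does)
open import Relation.Nullary.Decidable using (T?)

open Equivalence using (to; from)

indicator : Bool → ℕ
indicator true  = 1
indicator false = 0

count-tabulate : ∀ {A : Set} n (g : Fin n → A) (p : A → Bool) →
                 length (filterᵇ p (tabulate g)) ≡ count (p ∘ g)
count-tabulate zero    g p = refl
count-tabulate (suc n) g p with p (g zero)
... | true  = cong suc (trans (count-tabulate n (g ∘ suc) p) (sym (count-tabulate n suc (p ∘ g))))
... | false = trans (count-tabulate n (g ∘ suc) p) (sym (count-tabulate n suc (p ∘ g)))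

count-suc : ∀ {n} (p : Fin (suc n) → Bool) → count p ≡ indicator (p zero) + count (p ∘ suc)
count-suc p with p zero
... | true  = cong suc (count-tabulate _ suc p)
... | false = count-tabulate _ suc p

count-cong : ∀ {n} {p q : Fin n → Bool} → (∀ i → p i ≡ q i) → count p ≡ count q
count-cong {zero}          p≗q = refl
count-cong {suc n} {p} {q} p≗q = begin
  count p                               ≡⟨ count-suc p ⟩
  indicator (p zero) + count (p ∘ suc)
    ≡⟨ cong₂ _+_ (cong indicator (p≗q zero)) (count-cong (p≗q ∘ suc)) ⟩
  indicator (q zero) + count (q ∘ suc)   ≡⟨ count-suc q ⟨
  count q                               ∎
  where open ≡-Reasoning

count-punchIn : ∀ {n} (v : Fin (suc n)) (p : Fin (suc n) → Bool) →
                count p ≡ indicator (p v) + count (p ∘ punchIn v)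
count-punchIn zero            p = count-suc p
count-punchIn {suc n} (suc v) p = begin
  count p                                ≡⟨ count-suc p ⟩
  a + count (p ∘ suc)                    ≡⟨ cong (a +_) (count-punchIn v (p ∘ suc)) ⟩
  a + (b + count (p ∘ suc ∘ punchIn v))  ≡⟨ x∙yz≈y∙xz a b _ ⟩
  b + (a + count (p ∘ suc ∘ punchIn v))  ≡⟨ cong (b +_) (count-suc (p ∘ punchIn (suc v))) ⟨
  b + count (p ∘ punchIn (suc v))        ∎
  where
  open ≡-Reasoning
  a = indicator (p zero)
  b = indicator (p (suc v))

count≤n : ∀ {n} (p : Fin n → Bool) → count p ≤ n
count≤n {n} p =
  ≤-trans (length-filter (T? ∘ p) (allFin n)) (≤-reflexive (length-tabulate (λ i → i)))

count≤n-if-false : ∀ {n} (p : Fin (suc n) → Bool) (x : Fin (suc n)) → p x ≡ false → count p ≤ n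
count≤n-if-false {n} p x px≡false = begin
  count p                                  ≡⟨ count-punchIn x p ⟩
  indicator (p x) + count (p ∘ punchIn x)  ≡⟨ cong (λ b → indicator b + count (p ∘ punchIn x)) px≡false ⟩
  count (p ∘ punchIn x)                    ≤⟨ count≤n (p ∘ punchIn x) ⟩
  n                                        ∎
  where open ≤-Reasoning

count-none : ∀ {n} {p : Fin n → Bool} → (∀ i → p i ≡ false) → count p ≡ 0
count-none {zero}      _ = refl
count-none {suc n} {p} p≡false =
  trans (count-suc p) (cong₂ _+_ (cong indicator (p≡false zero)) (count-none (p≡false ∘ suc)))

count-unique : ∀ {n} {p : Fin n → Bool} (a : Fin n) → p a ≡ true →
               (∀ i → p i ≡ true → i ≡ a) → count p ≡ 1
count-unique {suc n} {p} a pa unique =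
  trans (count-punchIn a p) (cong₂ _+_ (cong indicator pa)
    (count-none λ i → ¬-not (punchInᵢ≢i a i ∘ unique (punchIn a i))))

adj⇒≢ : ∀ {n} (G : Graph n) {u v} → adj G u v ≡ true → u ≢ v
adj⇒≢ G {u} e refl with () ← trans (sym e) (irrefl G u)

record EliminationOrder (t : ℕ) {n : ℕ} (H : Graph n) : Set where
  field
    rank           : Fin n → ℕ
    rank<n         : ∀ x → rank x < n
    rank-injective : ∀ x y → rank x ≡ rank y → x ≡ y
    back-degree≤   : ∀ x → count (λ z → adj H x z ∧ (rank z <ᵇ rank x)) ≤ t
    back-clique    : ∀ x y z → adj H x y ≡ true → adj H x z ≡ true →
                     rank y < rank x → rank z < rank x → y ≢ z → adj H y z ≡ true

completeOrder : ∀ {t} (H : Graph (suc t)) → IsComplete H → EliminationOrder t H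
completeOrder H complete = record
  { rank           = toℕ
  ; rank<n         = toℕ<n
  ; rank-injective = λ _ _ → toℕ-injective
  ; back-degree≤   = λ x → count≤n-if-false (λ z → adj H x z ∧ (toℕ z <ᵇ toℕ x)) x
                              (cong (_∧ (toℕ x <ᵇ toℕ x)) (irrefl H x))
  ; back-clique    = λ _ y z _ _ _ _ y≢z → complete y z y≢z
  }

data PunchInView {n : ℕ} (v : Fin (suc n)) : Fin (suc n) → Set where
  at-v      : PunchInView v v
  punchedIn : ∀ i → PunchInView v (punchIn v i)

punchInView : ∀ {n} (v x : Fin (suc n)) → PunchInView v x
punchInView v x with v ≟ᶠ x
... | yes refl = at-v
... | no  v≢x  = subst (PunchInView v) (punchIn-punchOut v≢x) (punchedIn (punchOut v≢x))

-- The added vertex is ranked last, so its back neighbours are all its neighbours.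
module Extend {t n : ℕ} (H : Graph (suc n)) (v : Fin (suc n)) (degree≡t : degree H v ≡ t)
              (clique : NbhdClique H v) (O : EliminationOrder t (deleteV H v)) where

  private module O = EliminationOrder O

  rank : Fin (suc n) → ℕ
  rank x with v ≟ᶠ x
  ... | yes _   = n
  ... | no  v≢x = O.rank (punchOut v≢x)

  rank-v : rank v ≡ n
  rank-v with v ≟ᶠ v
  ... | yes _   = refl
  ... | no  v≢v = ⊥-elim (v≢v refl)

  rank-punchIn : ∀ i → rank (punchIn v i) ≡ O.rank i
  rank-punchIn i with v ≟ᶠ punchIn v i
  ... | yes v≡ = ⊥-elim (punchInᵢ≢i v i (sym v≡))
  ... | no  v≢ = cong O.rank (trans (punchOut-cong v refl) (punchOut-punchIn v))

  rank<1+n : ∀ x → rank x < suc n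
  rank<1+n x with punchInView v x
  ... | at-v        = ≤-reflexive (cong suc rank-v)
  ... | punchedIn i = ≤-trans (≤-reflexive (cong suc (rank-punchIn i))) (m≤n⇒m≤1+n (O.rank<n i))

  rank-injective : ∀ x y → rank x ≡ rank y → x ≡ y
  rank-injective x y rx≡ry with punchInView v x | punchInView v y
  ... | at-v        | at-v        = refl
  ... | at-v        | punchedIn j =
    ⊥-elim (<-irrefl (trans (sym (rank-punchIn j)) (trans (sym rx≡ry) rank-v)) (O.rank<n j))
  ... | punchedIn i | at-v        =
    ⊥-elim (<-irrefl (trans (sym (rank-punchIn i)) (trans rx≡ry rank-v)) (O.rank<n i))
  ... | punchedIn i | punchedIn j =
    cong (punchIn v) (O.rank-injective i j (trans (sym (rank-punchIn i)) (trans rx≡ry (rank-punchIn j))))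

  back-of-v : ∀ z → (adj H v z ∧ (rank z <ᵇ rank v)) ≡ adj H v z
  back-of-v z with punchInView v z
  ... | at-v        rewrite irrefl H v = refl
  ... | punchedIn j rewrite rank-punchIn j | rank-v =
    trans (cong (adj H v (punchIn v j) ∧_) (to T-≡ (<⇒<ᵇ (O.rank<n j)))) (∧-identityʳ _)

  v-not-back-of-punchIn : ∀ i → (adj H (punchIn v i) v ∧ (rank v <ᵇ rank (punchIn v i))) ≡ false
  v-not-back-of-punchIn i = trans (cong (adj H (punchIn v i) v ∧_) (¬-not v≮)) (∧-zeroʳ _)
    where
    v≮ : (rank v <ᵇ rank (punchIn v i)) ≢ true
    v≮ e = <-asym (O.rank<n i) (subst₂ _<_ rank-v (rank-punchIn i) (<ᵇ⇒< _ _ (from T-≡ e)))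

  back-of-punchIn : ∀ i j →
    (adj H (punchIn v i) (punchIn v j) ∧ (rank (punchIn v j) <ᵇ rank (punchIn v i)))
      ≡ (adj (deleteV H v) i j ∧ (O.rank j <ᵇ O.rank i))
  back-of-punchIn i j rewrite rank-punchIn i | rank-punchIn j = refl

  back-degree≤ : ∀ x → count (λ z → adj H x z ∧ (rank z <ᵇ rank x)) ≤ t
  back-degree≤ x with punchInView v x
  ... | at-v        = ≤-reflexive (trans (count-cong back-of-v) degree≡t)
  ... | punchedIn i = begin
    count p                                  ≡⟨ count-punchIn v p ⟩
    indicator (p v) + count (p ∘ punchIn v)
      ≡⟨ cong₂ (λ b c → indicator b + c) (v-not-back-of-punchIn i) (count-cong (back-of-punchIn i)) ⟩
    count (λ j → adj (deleteV H v) i j ∧ (O.rank j <ᵇ O.rank i)) ≤⟨ O.back-degree≤ i ⟩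
    t                                        ∎
    where
    open ≤-Reasoning
    p : Fin (suc n) → Bool
    p z = adj H (punchIn v i) z ∧ (rank z <ᵇ rank (punchIn v i))

  back-clique : ∀ x y z → adj H x y ≡ true → adj H x z ≡ true →
                rank y < rank x → rank z < rank x → y ≢ z → adj H y z ≡ true
  back-clique x y z xy xz y<x z<x y≢z with punchInView v x
  ... | at-v = clique y z xy xz y≢z
  ... | punchedIn i with punchInView v y | punchInView v z
  ... | at-v        | _           = ⊥-elim (<-asym (O.rank<n i) (subst₂ _<_ rank-v (rank-punchIn i) y<x))
  ... | punchedIn j | at-v        = ⊥-elim (<-asym (O.rank<n i) (subst₂ _<_ rank-v (rank-punchIn i) z<x))
  ... | punchedIn j | punchedIn l =
    O.back-clique i j l xy xz (subst₂ _<_ (rank-punchIn j) (rank-punchIn i) y<x)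
      (subst₂ _<_ (rank-punchIn l) (rank-punchIn i) z<x) (y≢z ∘ cong (punchIn v))

  order : EliminationOrder t H
  order = record
    { rank = rank ; rank<n = rank<1+n ; rank-injective = rank-injective
    ; back-degree≤ = back-degree≤ ; back-clique = back-clique }

ttree⇒eliminationOrder : ∀ {t n} {H : Graph n} → TTree t H → EliminationOrder t H
ttree⇒eliminationOrder (base H complete)              = completeOrder H complete
ttree⇒eliminationOrder (extend H v degree≡t clique T) =
  Extend.order H v degree≡t clique (ttree⇒eliminationOrder T)

search : ℕ → ℕ → List ℕ → ℕ
search zero     s L = s
search (suc f) s L = if does (s ∈? L) then search f (suc s) L else s

search≤ : ∀ f s L → search f s L ≤ f + s
search≤ zero    s L = ≤-refl
search≤ (suc f) s L with s ∈? L
... | yes _ = subst (search f (suc s) L ≤_) (+-suc f s) (search≤ f (suc s) L)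
... | no  _ = m≤n+m s (suc f)

search-∈ : ∀ f s L → search f s L ∈ L → ∀ i → s ≤ i → i ≤ f + s → i ∈ L
search-∈ zero    s L found i s≤i i≤s = subst (_∈ L) (≤-antisym s≤i i≤s) found
search-∈ (suc f) s L found i s≤i i≤f+s with s ∈? L
... | no  s∉L = ⊥-elim (s∉L found)
... | yes s∈L with s ≟ i
...   | yes refl = s∈L
...   | no  s≢i  =
  search-∈ f (suc s) L found i (≤∧≢⇒< s≤i s≢i) (subst (i ≤_) (sym (+-suc f s)) i≤f+s)

≤c⊆⇒c<length : ∀ (L : List ℕ) c → (∀ i → i ≤ c → i ∈ L) → c < length L
≤c⊆⇒c<length L c covers = ≰⇒> pigeon
  where
  slot : Fin (suc c) → Fin (length L)
  slot i = index (covers (toℕ i) (toℕ≤pred[n] i))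

  slot-injective : ∀ i j → slot i ≡ slot j → i ≡ j
  slot-injective i j slot≡ = toℕ-injective (begin
    toℕ i             ≡⟨ lookup-index (covers (toℕ i) (toℕ≤pred[n] i)) ⟩
    lookup L (slot i) ≡⟨ cong (lookup L) slot≡ ⟩
    lookup L (slot j) ≡⟨ lookup-index (covers (toℕ j) (toℕ≤pred[n] j)) ⟨
    toℕ j             ∎)
    where open ≡-Reasoning

  pigeon : ¬ (length L ≤ c)
  pigeon length≤c with i , j , i<j , slot≡ ← pigeonhole (s≤s length≤c) slot =
    <-irrefl (cong toℕ (slot-injective i j slot≡)) i<j

mex : List ℕ → ℕ
mex L = search (length L) 0 L

mex≤length : ∀ L → mex L ≤ length L
mex≤length L = subst (mex L ≤_) (+-identityʳ _) (search≤ (length L) 0 L)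

mex-∉ : ∀ L → mex L ∉ L
mex-∉ L found = <-irrefl refl (≤c⊆⇒c<length L (length L) λ i i≤ →
  search-∈ (length L) 0 L found i z≤n (subst (i ≤_) (sym (+-identityʳ _)) i≤))

module Greedy {k : ℕ} (key : Fin k → ℕ) (forbidden : Fin k → List (Fin k))
              (forbidden-earlier : ∀ u w → w ∈ forbidden u → key w < key u) where

  -- r rounds of recolouring every vertex by the mex of its forbidden colours; the colour of u
  -- is final after key u + 1 rounds.
  colourAfter : ℕ → Fin k → ℕ
  colourAfter zero    u = 0
  colourAfter (suc r) u = mex (map (colourAfter r) (forbidden u))

  colourAfter-stable : ∀ r s u → key u < r → key u < s → colourAfter r u ≡ colourAfter s u
  colourAfter-stable (suc r) (suc s) u u<r u<s = cong mex (map-cong-local (All.tabulate λ {w} w∈ →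
    colourAfter-stable r s w (<-≤-trans (forbidden-earlier u w w∈) (≤-pred u<r))
                             (<-≤-trans (forbidden-earlier u w w∈) (≤-pred u<s))))

  greedy : Fin k → ℕ
  greedy u = colourAfter (suc (key u)) u

  greedy-mex : ∀ u → greedy u ≡ mex (map greedy (forbidden u))
  greedy-mex u = cong mex (map-cong-local (All.tabulate λ {w} w∈ →
    colourAfter-stable (key u) (suc (key w)) w (forbidden-earlier u w w∈) ≤-refl))

  greedy≤ : ∀ u → greedy u ≤ length (forbidden u)
  greedy≤ u = subst₂ _≤_ (sym (greedy-mex u)) (length-map greedy (forbidden u))
                         (mex≤length (map greedy (forbidden u)))

  greedy-avoids : ∀ u w → w ∈ forbidden u → greedy u ≢ greedy w
  greedy-avoids u w w∈ same-colour = mex-∉ (map greedy (forbidden u))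
    (subst (_∈ map greedy (forbidden u)) (trans (sym same-colour) (greedy-mex u)) (∈-map⁺ greedy w∈))

leastBy : ∀ {A : Set} → (A → ℕ) → List A → Maybe A
leastBy f []       = nothing
leastBy f (x ∷ xs) = just (argmin f x xs)

leastBy-∈ : ∀ {A : Set} (f : A → ℕ) xs {a} → leastBy f xs ≡ just a → a ∈ xs
leastBy-∈ f (x ∷ xs) refl with argmin-sel f x xs
... | inj₁ ≡x  = here ≡x
... | inj₂ ∈xs = there ∈xs

leastBy-≤ : ∀ {A : Set} (f : A → ℕ) xs {a y} → leastBy f xs ≡ just a → y ∈ xs → f a ≤ f y
leastBy-≤ f (x ∷ xs) refl (here refl) = f[argmin]≤f[⊤] {f = f} x xs
leastBy-≤ f (x ∷ xs) refl (there y∈) = All.lookup (f[argmin]≤f[xs] {f = f} x xs) y∈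

leastBy-nonempty : ∀ {A : Set} (f : A → ℕ) {xs y} → y ∈ xs → ∃ λ a → leastBy f xs ≡ just a
leastBy-nonempty f {x ∷ xs} _ = argmin f x xs , refl

data Close : ℕ → ℕ → Set where
  flat : ∀ {a} → Close a a
  up   : ∀ {a} → Close a (suc a)
  down : ∀ {a} → Close (suc a) a

+1⇒Close : ∀ {a b} → a + 1 ≡ b → Close a b
+1⇒Close {a} refl rewrite +-comm a 1 = up

Close-sym : ∀ {a b} → Close a b → Close b a
Close-sym flat = flat
Close-sym up   = down
Close-sym down = up

pathAdj⇒Close : ∀ {m} (i j : Fin m) → pathAdj i j ≡ true → Close (toℕ i) (toℕ j)
pathAdj⇒Close i j i~j with toℕ i + 1 ≡ᵇ toℕ j in i+1≡j
... | true  = +1⇒Close (≡ᵇ⇒≡ _ _ (from T-≡ i+1≡j))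
... | false = Close-sym (+1⇒Close (≡ᵇ⇒≡ _ _ (from T-≡ i~j)))

rows±1 rows±2 rowsBelow : ℕ → List ℕ
rows±1   y = y ∸ 1 ∷ y ∷ suc y ∷ []
rows±2   y = y ∸ 2 ∷ y ∸ 1 ∷ y ∷ suc y ∷ suc (suc y) ∷ []
rowsBelow y = y ∸ 1 ∷ y ∸ 2 ∷ []

Close⇒rows±1 : ∀ {y b} → Close y b → b ∈ rows±1 y
Close⇒rows±1 flat = there (here refl)
Close⇒rows±1 up   = there (there (here refl))
Close⇒rows±1 down = here refl

rows±1⊆rows±2 : ∀ {y b} → b ∈ rows±1 y → b ∈ rows±2 y
rows±1⊆rows±2 (here b≡)                 = there (here b≡)
rows±1⊆rows±2 (there (here b≡))         = there (there (here b≡))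
rows±1⊆rows±2 (there (there (here b≡))) = there (there (there (here b≡)))

Close²⇒rows±2 : ∀ {y a b} → Close y a → Close a b → b ∈ rows±2 y
Close²⇒rows±2 flat c    = rows±1⊆rows±2 (Close⇒rows±1 c)
Close²⇒rows±2 up   flat = there (there (there (here refl)))
Close²⇒rows±2 up   up   = there (there (there (there (here refl))))
Close²⇒rows±2 up   down = there (there (here refl))
Close²⇒rows±2 down flat = there (here refl)
Close²⇒rows±2 down up   = there (there (here refl))
Close²⇒rows±2 (down {suc a}) down = here refl

Close-below : ∀ {y b} → Close y b → b < y → b ≡ y ∸ 1
Close-below flat b<y = ⊥-elim (<-irrefl refl b<y)
Close-below up   b<y = ⊥-elim (<-asym b<y (n<1+n _))
Close-below down _   = refl

Close²-below : ∀ {y a b} → Close y a → Close a b → b < y → b ∈ rowsBelow y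
Close²-below flat c    b<y = here (Close-below c b<y)
Close²-below up   flat b<y = ⊥-elim (<-asym b<y (n<1+n _))
Close²-below up   up   b<y = ⊥-elim (<-asym b<y (<-trans (n<1+n _) (n<1+n _)))
Close²-below up   down b<y = ⊥-elim (<-irrefl refl b<y)
Close²-below down flat _   = here refl
Close²-below down up   b<y = ⊥-elim (<-irrefl refl b<y)
Close²-below (down {suc a}) down _ = there (here refl)

∈-mapMaybe⁺ : ∀ {A B : Set} (g : A → Maybe B) {xs a b} → a ∈ xs → g a ≡ just b → b ∈ mapMaybe g xs
∈-mapMaybe⁺ g {x ∷ xs} (here refl) ga rewrite ga = here refl
∈-mapMaybe⁺ g {x ∷ xs} (there a∈) ga with g x
... | nothing = ∈-mapMaybe⁺ g a∈ ga
... | just _  = there (∈-mapMaybe⁺ g a∈ ga)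

length-cartesianProduct : ∀ {A B : Set} (xs : List A) (ys : List B) →
                          length (cartesianProduct xs ys) ≡ length xs * length ys
length-cartesianProduct []       ys = refl
length-cartesianProduct (x ∷ xs) ys =
  trans (length-++ (map (x ,_) ys)) (cong₂ _+_ (length-map (x ,_) ys) (length-cartesianProduct xs ys))

usesAtMost-if-< : ∀ {k} (φ : Fin k → ℕ) c → (∀ u → φ u < c) → UsesAtMost φ c
usesAtMost-if-< φ c φ<c = upTo c , ≤-reflexive (length-upTo c) , λ u → ∈-upTo⁺ (φ<c u)

module Order {t n : ℕ} {H : Graph n} (O : EliminationOrder t H) where

  open EliminationOrder O public

  back : Fin n → List (Fin n)
  back x = filterᵇ (λ z → adj H x z ∧ (rank z <ᵇ rank x)) (allFin n)

  length-back : ∀ x → length (back x) ≤ t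
  length-back = back-degree≤

  ∈-back : ∀ {x z} → adj H x z ≡ true → rank z < rank x → z ∈ back x
  ∈-back {x} {z} xz z<x = ∈-filter⁺ (T? ∘ λ z → adj H x z ∧ (rank z <ᵇ rank x)) (∈-allFin z)
    (from T-∧ (from T-≡ xz , <⇒<ᵇ z<x))

  AdjOrEq : Fin n → Fin n → Set
  AdjOrEq a b = a ≡ b ⊎ adj H a b ≡ true

  back-through : ∀ {a b c} → AdjOrEq a b → AdjOrEq b c → rank a ≤ rank b → rank c < rank a →
                 adj H a c ≡ true
  back-through (inj₁ refl) (inj₁ refl) _   c<a = ⊥-elim (<-irrefl refl c<a)
  back-through (inj₁ refl) (inj₂ bc)   _   _   = bc
  back-through (inj₂ ab)   (inj₁ refl) a≤b c<a = ⊥-elim (<-irrefl refl (<-≤-trans c<a a≤b))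
  back-through {a} {b} {c} (inj₂ ab) (inj₂ bc) a≤b c<a =
    trans (Graph.sym H a c) (back-clique b c a bc (trans (Graph.sym H b a) ab) (<-trans c<a a<b) a<b c≢a)
    where
    a<b : rank a < rank b
    a<b = ≤∧≢⇒< a≤b (adj⇒≢ H ab ∘ rank-injective a b)
    c≢a : c ≢ a
    c≢a c≡a = <-irrefl (cong rank c≡a) c<a

module OddColouring {t n m k : ℕ} (H : Graph n) (O : EliminationOrder t H) (G : Graph k)
  (f : Fin k → Fin n × Fin m) (f-injective : ∀ u v → f u ≡ f v → u ≡ v)
  (f-edge : ∀ u v → adj G u v ≡ true → StrongAdj (adj H) (pathAdj {m}) (f u) (f v)) where

  open Order O

  column : Fin k → Fin n
  column u = proj₁ (f u)

  row : Fin k → ℕ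
  row u = toℕ (proj₂ (f u))

  pos : Fin k → Fin n × ℕ
  pos u = column u , row u

  pos-injective : ∀ {u w} → pos u ≡ pos w → u ≡ w
  pos-injective {u} {w} u≡w =
    f-injective u w (×-≡,≡→≡ (cong proj₁ u≡w , toℕ-injective (cong proj₂ u≡w)))

  -- Lexicographic in (rank of the column, row), as row u < m.
  key : Fin k → ℕ
  key u = rank (column u) * m + row u

  rank<⇒key< : ∀ {w u} → rank (column w) < rank (column u) → key w < key u
  rank<⇒key< {w} {u} w<u = begin-strict
    rank (column w) * m + row w  <⟨ +-monoʳ-< _ (toℕ<n (proj₂ (f w))) ⟩
    rank (column w) * m + m      ≡⟨ +-comm _ m ⟩
    suc (rank (column w)) * m    ≤⟨ *-monoˡ-≤ m w<u ⟩
    rank (column u) * m          ≤⟨ m≤m+n _ _ ⟩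
    key u                        ∎
    where open ≤-Reasoning

  key<⇒rank≤ : ∀ {w u} → key w < key u → rank (column w) ≤ rank (column u)
  key<⇒rank≤ w<u = ≮⇒≥ λ u<w → <-asym w<u (rank<⇒key< u<w)

  key<⇒rank< : ∀ {w u} → key w < key u → column w ≢ column u → rank (column w) < rank (column u)
  key<⇒rank< w<u w≢u = ≤∧≢⇒< (key<⇒rank≤ w<u) (w≢u ∘ rank-injective _ _)

  key<⇒row< : ∀ {w u} → key w < key u → column w ≡ column u → row w < row u
  key<⇒row< {w} {u} w<u w≡u rewrite w≡u = +-cancelˡ-< (rank (column u) * m) (row w) (row u) w<u

  key-injective : ∀ {w u} → key w ≡ key u → w ≡ u
  key-injective {w} {u} w≡u with <-cmp (rank (column w)) (rank (column u))
  ... | tri< r< _ _ = ⊥-elim (<-irrefl w≡u (rank<⇒key< r<))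
  ... | tri> _ _ r> = ⊥-elim (<-irrefl (sym w≡u) (rank<⇒key< r>))
  ... | tri≈ _ r≡ _ = pos-injective (cong₂ _,_ (rank-injective _ _ r≡)
    (+-cancelˡ-≡ (rank (column u) * m) (row w) (row u)
      (trans (cong (λ r → r * m + row w) (sym r≡)) w≡u)))

  edge⇒near : ∀ {u w} → adj G u w ≡ true → AdjOrEq (column u) (column w) × Close (row u) (row w)
  edge⇒near {u} {w} uw with f-edge u w uw
  ... | inj₁ (h , y≡)         = inj₂ h , subst (λ y → Close (row u) (toℕ y)) y≡ flat
  ... | inj₂ (inj₁ (x≡ , p)) = inj₁ x≡ , pathAdj⇒Close _ _ p
  ... | inj₂ (inj₂ (h , p))  = inj₂ h , pathAdj⇒Close _ _ p

  -- Where an earlier vertex within distance 2 (resp. 1) of u can sit: near row u in a column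
  -- behind column u, or just below u in its own column.
  window₂ window₁ : Fin k → List (Fin n × ℕ)
  window₂ u = cartesianProduct (back (column u)) (rows±2 (row u)) ++ map (column u ,_) (rowsBelow (row u))
  window₁ u = cartesianProduct (back (column u)) (rows±1 (row u)) ++ (column u , row u ∸ 1) ∷ []

  length-window₂ : ∀ u → length (window₂ u) ≡ length (back (column u)) * 5 + 2
  length-window₂ u = trans (length-++ (cartesianProduct (back (column u)) (rows±2 (row u))))
    (cong (_+ 2) (length-cartesianProduct (back (column u)) (rows±2 (row u))))

  length-window₁ : ∀ u → length (window₁ u) ≡ length (back (column u)) * 3 + 1
  length-window₁ u = trans (length-++ (cartesianProduct (back (column u)) (rows±1 (row u))))
    (cong (_+ 1) (length-cartesianProduct (back (column u)) (rows±1 (row u))))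

  window₁⊆window₂ : ∀ {u p} → p ∈ window₁ u → p ∈ window₂ u
  window₁⊆window₂ {u} p∈ with ∈-++⁻ (cartesianProduct (back (column u)) (rows±1 (row u))) p∈
  ... | inj₁ p∈× with z∈ , j∈ ← ∈-cartesianProduct⁻ (back (column u)) (rows±1 (row u)) p∈× =
    ∈-++⁺ˡ (∈-cartesianProduct⁺ z∈ (rows±1⊆rows±2 j∈))
  ... | inj₂ (here p≡) = ∈-++⁺ʳ _ (here p≡)

  earlier-neighbour∈window₁ : ∀ {u w} → adj G u w ≡ true → key w < key u → pos w ∈ window₁ u
  earlier-neighbour∈window₁ {u} {w} uw w<u with edge⇒near uw
  ... | inj₁ u≡w , c = ∈-++⁺ʳ _ (here (cong₂ _,_ (sym u≡w) (Close-below c (key<⇒row< w<u (sym u≡w)))))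
  ... | inj₂ h   , c = ∈-++⁺ˡ (∈-cartesianProduct⁺
    (∈-back h (key<⇒rank< w<u λ w≡u → adj⇒≢ H h (sym w≡u))) (Close⇒rows±1 c))

  two-step∈window₂ : ∀ {u v w} → adj G u v ≡ true → key u < key v → adj G v w ≡ true → key w < key u →
                     pos w ∈ window₂ u
  two-step∈window₂ {u} {v} {w} uv u<v vw w<u with edge⇒near uv | edge⇒near vw | column w ≟ᶠ column u
  ... | _ , c₁ | _ , c₂ | yes w≡u = ∈-++⁺ʳ _
    (subst (λ x → (x , row w) ∈ map (column u ,_) (rowsBelow (row u))) (sym w≡u)
      (∈-map⁺ (column u ,_) (Close²-below c₁ c₂ (key<⇒row< w<u w≡u))))
  ... | r₁ , c₁ | r₂ , c₂ | no  w≢u = ∈-++⁺ˡ (∈-cartesianProduct⁺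
    (∈-back (back-through r₁ r₂ (key<⇒rank≤ u<v) (key<⇒rank< w<u w≢u)) (key<⇒rank< w<u w≢u))
    (Close²⇒rows±2 c₁ c₂))

  occupant : Fin n × ℕ → Maybe (Fin k)
  occupant p with any? (λ w → ≡-dec _≟ᶠ_ _≟_ (pos w) p)
  ... | yes (w , _) = just w
  ... | no  _       = nothing

  occupant-pos : ∀ w → occupant (pos w) ≡ just w
  occupant-pos w with any? (λ w′ → ≡-dec _≟ᶠ_ _≟_ (pos w′) (pos w))
  ... | yes (w′ , w′≡w) = cong just (pos-injective w′≡w)
  ... | no  none        = ⊥-elim (none (w , refl))

  neighbours : Fin k → List (Fin k)
  neighbours v = filterᵇ (adj G v) (allFin k)

  ∈-neighbours : ∀ {v w} → adj G v w ≡ true → w ∈ neighbours v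
  ∈-neighbours {v} {w} vw = ∈-filter⁺ (T? ∘ adj G v) (∈-allFin w) (from T-≡ vw)

  leastNeighbour : Fin k → Maybe (Fin k)
  leastNeighbour v = leastBy key (neighbours v)

  leastNeighbour-adj : ∀ {v w} → leastNeighbour v ≡ just w → adj G v w ≡ true
  leastNeighbour-adj {v} least =
    to T-≡ (proj₂ (∈-filter⁻ (T? ∘ adj G v) {xs = allFin k} (leastBy-∈ key (neighbours v) least)))

  leastNeighbour-≤ : ∀ {v w w′} → leastNeighbour v ≡ just w → adj G v w′ ≡ true → key w ≤ key w′
  leastNeighbour-≤ {v} least vw′ = leastBy-≤ key (neighbours v) least (∈-neighbours vw′)

  conflicts : Fin k → List (Fin k)
  conflicts u =
    mapMaybe occupant (window₂ u) ++ mapMaybe (λ p → occupant p >>= leastNeighbour) (window₁ u)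

  forbidden : Fin k → List (Fin k)
  forbidden u = filter (λ w → key w <? key u) (conflicts u)

  forbidden-earlier : ∀ u w → w ∈ forbidden u → key w < key u
  forbidden-earlier u w w∈ = proj₂ (∈-filter⁻ (λ w → key w <? key u) {xs = conflicts u} w∈)

  length-forbidden : ∀ u → length (forbidden u) ≤ 8 * t + 3
  length-forbidden u = begin
    length (forbidden u)
      ≤⟨ length-filter (λ w → key w <? key u) (conflicts u) ⟩
    length (conflicts u)
      ≡⟨ length-++ (mapMaybe occupant (window₂ u)) ⟩
    length (mapMaybe occupant (window₂ u)) + length (mapMaybe _ (window₁ u))
      ≤⟨ +-mono-≤ (length-mapMaybe occupant (window₂ u)) (length-mapMaybe _ (window₁ u)) ⟩
    length (window₂ u) + length (window₁ u)
      ≡⟨ cong₂ _+_ (length-window₂ u) (length-window₁ u) ⟩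
    b * 5 + 2 + (b * 3 + 1)
      ≡⟨ lemma b ⟩
    8 * b + 3
      ≤⟨ +-monoˡ-≤ 3 (*-monoʳ-≤ 8 (length-back (column u))) ⟩
    8 * t + 3 ∎
    where
    open ≤-Reasoning
    b = length (back (column u))
    lemma : ∀ b → b * 5 + 2 + (b * 3 + 1) ≡ 8 * b + 3
    lemma = solve-∀

  forbidden-window₂ : ∀ {u p w} → p ∈ window₂ u → occupant p ≡ just w → key w < key u →
                      w ∈ forbidden u
  forbidden-window₂ {u} p∈ occupied w<u =
    ∈-filter⁺ (λ w → key w <? key u) (∈-++⁺ˡ (∈-mapMaybe⁺ occupant p∈ occupied)) w<u

  forbidden-window₁ : ∀ {u p v w} → p ∈ window₁ u → occupant p ≡ just v → leastNeighbour v ≡ just w →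
                      key w < key u → w ∈ forbidden u
  forbidden-window₁ {u} {p} {v} {w} p∈ occupied least w<u =
    ∈-filter⁺ (λ w → key w <? key u)
      (∈-++⁺ʳ (mapMaybe occupant (window₂ u))
        (∈-mapMaybe⁺ (λ p → occupant p >>= leastNeighbour) p∈ bound)) w<u
    where
    bound : (occupant p >>= leastNeighbour) ≡ just w
    bound = trans (cong (_>>= leastNeighbour) occupied) least

  neighbour-forbidden : ∀ {u w} → adj G u w ≡ true → key w < key u → w ∈ forbidden u
  neighbour-forbidden {w = w} uw w<u =
    forbidden-window₂ (window₁⊆window₂ (earlier-neighbour∈window₁ uw w<u)) (occupant-pos w) w<u

  leastNeighbour-forbidden : ∀ {u v w} → adj G u v ≡ true → leastNeighbour v ≡ just w → key w < key u →
                             w ∈ forbidden u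
  leastNeighbour-forbidden {u} {v} {w} uv least w<u with <-cmp (key v) (key u)
  ... | tri< v<u _ _ = forbidden-window₁ (earlier-neighbour∈window₁ uv v<u) (occupant-pos v) least w<u
  ... | tri≈ _ v≡u _ = ⊥-elim (adj⇒≢ G uv (sym (key-injective v≡u)))
  ... | tri> _ _ u<v =
    forbidden-window₂ (two-step∈window₂ uv u<v (leastNeighbour-adj least) w<u) (occupant-pos w) w<u

  open Greedy key forbidden forbidden-earlier public

  proper : IsProper G greedy
  proper u w uw with <-cmp (key w) (key u)
  ... | tri< w<u _ _ = greedy-avoids u w (neighbour-forbidden uw w<u)
  ... | tri≈ _ w≡u _ = ⊥-elim (adj⇒≢ G uw (sym (key-injective w≡u)))
  ... | tri> _ _ u<w = greedy-avoids w u (neighbour-forbidden (trans (Graph.sym G w u) uw) u<w) ∘ sym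

  leastNeighbour-colour-unique : ∀ {v w₀ i} → leastNeighbour v ≡ just w₀ → adj G v i ≡ true →
                                 greedy i ≡ greedy w₀ → i ≡ w₀
  leastNeighbour-colour-unique {v} {w₀} {i} least vi same-colour with i ≟ᶠ w₀
  ... | yes i≡w₀ = i≡w₀
  ... | no  i≢w₀ = ⊥-elim (greedy-avoids i w₀
    (leastNeighbour-forbidden (trans (Graph.sym G i v) vi) least w₀<i) same-colour)
    where
    w₀<i : key w₀ < key i
    w₀<i = ≤∧≢⇒< (leastNeighbour-≤ least vi) (i≢w₀ ∘ sym ∘ key-injective)

  odd : IsOdd G greedy
  odd v (w , vw) with w₀ , least ← leastBy-nonempty key (∈-neighbours vw) =
    greedy w₀ , cong (_% 2) (count-unique w₀ w₀-counted unique)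
    where
    w₀-counted : (adj G v w₀ ∧ (greedy w₀ ≡ᵇ greedy w₀)) ≡ true
    w₀-counted =
      to T-≡ (from T-∧ (from T-≡ (leastNeighbour-adj least) , ≡⇒≡ᵇ (greedy w₀) (greedy w₀) refl))
    unique : ∀ i → (adj G v i ∧ (greedy i ≡ᵇ greedy w₀)) ≡ true → i ≡ w₀
    unique i counted with vi , same-colour ← to T-∧ (from T-≡ counted) =
      leastNeighbour-colour-unique least (to T-≡ vi) (≡ᵇ⇒≡ _ _ same-colour)

  usesAtMost : UsesAtMost greedy (8 * t + 4)
  usesAtMost = usesAtMost-if-< greedy (8 * t + 4) λ u →
    subst (greedy u <_) (sym (+-suc (8 * t) 3)) (s≤s (≤-trans (greedy≤ u) (length-forbidden u)))

theorem1 : (t n m k : ℕ) (H : Graph n) → TTree t H →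
    (G : Graph k) → IsSubgraphOfStrongPath G H m →
    Σ (Fin k → ℕ) λ φ → IsProper G φ × IsOdd G φ × UsesAtMost φ (8 * t + 4)
theorem1 t n m k H T G (f , f-injective , f-edge) = greedy , proper , odd , usesAtMost
  where open OddColouring H (ttree⇒eliminationOrder T) G f f-injective f-edge
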